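{- Let $c$ be a well-formed GCL command and $f$ a label with $\mathsf{okf}(c,f)$. Then in the automaton $\mathsf{aut}(c,f)$, every state $(n,s)$ with $n\neq f$ has at least one successor; i.e., the only states without successor are those with control point $f$.
   Context: Stores are total maps from integer variables to $\mathbb{Z}$. GCL commands: $c ::= \mathsf{skip}^n \mid x :=^n e \mid c;c \mid \mathsf{if}^n\, gcs\,\mathsf{fi} \mid \mathsf{do}^n\, gcs\,\mathsf{od}$, $gcs ::= e\to c \mid e\to c \,\square\, gcs$ (nonempty), $n\in\mathbb{Z}$ labels, always-defined expressions; $\mathsf{enab}(gcs)$ is the disjunction of guards. Well formed: well typed and every subcommand $\mathsf{if}^n gcs\,\mathsf{fi}$ has $\mathsf{enab}(gcs)$ true in every store. $\mathsf{lab}(c)$ is the label of $c$ ($\mathsf{lab}(c;d)=\mathsf{lab}(c)$), $\mathsf{labs}(c)$ the set of its labels; $\mathsf{okf}(c,f)$: labels of $c$ positive and pairwise distinct, $f\notin\mathsf{labs}(c)$; $\mathsf{sub}(n,c)$ the subcommand labelled $n$ (defined for $n\in\mathsf{labs}(c)$). Following successor: $\mathsf{fsuc}(n,\mathsf{skip}^n,f)=\mathsf{fsuc}(n,x:=^ne,f)=\mathsf{fsuc}(n,\mathsf{if}^n\ldots,f)=\mathsf{fsuc}(n,\mathsf{do}^n\ldots,f)=f$; $\mathsf{fsuc}(n,c;d,f)=\mathsf{fsuc}(n,c,\mathsf{lab}(d))$ if $n\in\mathsf{labs}(c)$, else $\mathsf{fsuc}(n,d,f)$; for $m\in\mathsf{labs}(d)$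 with $e\to d$ in $gcs$: $\mathsf{fsuc}(m,\mathsf{if}^n gcs\,\mathsf{fi},f)=\mathsf{fsuc}(m,d,f)$, $\mathsf{fsuc}(m,\mathsf{do}^n gcs\,\mathsf{od},f)=\mathsf{fsuc}(m,d,n)$. Small steps: $\langle\mathsf{if}^n gcs\,\mathsf{fi},s\rangle\to\langle d,s\rangle$ and $\langle\mathsf{do}^n gcs\,\mathsf{od},s\rangle\to\langle d;\mathsf{do}^n gcs\,\mathsf{od},s\rangle$ for $e\to d\in gcs$ with $e$ true at $s$; $\langle\mathsf{do}^n gcs\,\mathsf{od},s\rangle\to\langle\mathsf{skip}^{ -n},s\rangle$ if $\mathsf{enab}(gcs)$ false at $s$; $\langle x:=^ne,s\rangle\to\langle\mathsf{skip}^{ -n},s[x\mapsto[\![e]\!](s)]\rangle$; $\langle\mathsf{skip}^n;c,s\rangle\to\langle c,s\rangle$; $\langle c;b,s\rangle\to\langle d;b,t\rangle$ if $\langle c,s\rangle\to\langle d,t\rangle$. $\mathsf{aut}(c,f)$ has control points $\mathsf{labs}(c)\cup\{f\}$, states $(n,s)$ with $s$ a store, and $(n,s)\Rightarrow(m,t)$ iff $\langle\mathsf{sub}(n,c),s\rangle\to\langle d,t\rangle$ with ($\mathsf{lab}(d)>0$ and $m=\mathsf{lab}(d)$) or ($\mathsf{lab}(d)<0$ and $m=\mathsf{fsuc}(n,c,f)$), or $\mathsf{sub}(n,c)=\mathsf{skip}^n$, $m=\mathsf{fsuc}(n,c,f)$ and $t=s$. -}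

module Defs where

open import Data.Nat using (ℕ; _≡ᵇ_)
open import Data.Integer using (ℤ; +_; -_; _<_)
open import Data.Bool using (Bool; true; false; _∨_; if_then_else_)
open import Data.List using (List; []; _∷_; _++_)
open import Data.List.Membership.Propositional using (_∈_; _∉_)
open import Data.List.Relation.Unary.All using (All)
open import Data.List.Relation.Unary.Unique.Propositional using (Unique)
open import Data.Product using (_×_)
open import Data.Sum using (_⊎_)
open import Relation.Binary.PropositionalEquality using (_≡_)

Var : Set
Var = ℕ

Store : Set
Store = Var → ℤ

-- Expressions are always defined; they are represented semantically
-- (shallow embedding).  Well typedness is enforced by the types:
-- integer expressions and boolean expressions (guards).
AExp : Set
AExp = Store → ℤ

BExp : Set
BExp = Store → Bool

Label : Set
Label = ℤ

_[_↦_] : Store → Var → ℤ → Store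
(s [ x ↦ v ]) y = if y ≡ᵇ x then v else s y

mutual
  data Cmd : Set where
    skip   : Label → Cmd
    assign : Label → Var → AExp → Cmd
    _⨾_    : Cmd → Cmd → Cmd
    ifc    : Label → GCs → Cmd
    doc    : Label → GCs → Cmd

  data GCs : Set where
    [_⇒_]   : BExp → Cmd → GCs
    _⇒_□_   : BExp → Cmd → GCs → GCs

data _⇒_∈gcs_ : BExp → Cmd → GCs → Set where
  here₁ : ∀ {e d} → e ⇒ d ∈gcs [ e ⇒ d ]
  here  : ∀ {e d gcs} → e ⇒ d ∈gcs (e ⇒ d □ gcs)
  there : ∀ {e d e' d' gcs} → e ⇒ d ∈gcs gcs → e ⇒ d ∈gcs (e' ⇒ d' □ gcs)

enab : GCs → Store → Bool
enab [ e ⇒ _ ] s = e s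
enab (e ⇒ _ □ gcs) s = e s ∨ enab gcs s

lab : Cmd → Label
lab (skip n) = n
lab (assign n _ _) = n
lab (c ⨾ _) = lab c
lab (ifc n _) = n
lab (doc n _) = n

mutual
  labs : Cmd → List Label
  labs (skip n) = n ∷ []
  labs (assign n _ _) = n ∷ []
  labs (c ⨾ d) = labs c ++ labs d
  labs (ifc n gcs) = n ∷ labsG gcs
  labs (doc n gcs) = n ∷ labsG gcs

  labsG : GCs → List Label
  labsG [ _ ⇒ c ] = labs c
  labsG (_ ⇒ c □ gcs) = labs c ++ labsG gcs

mutual
  data WF : Cmd → Set where
    wf-skip   : ∀ {n} → WF (skip n)
    wf-assign : ∀ {n x e} → WF (assign n x e)
    wf-seq    : ∀ {c d} → WF c → WF d → WF (c ⨾ d)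
    wf-if     : ∀ {n gcs} → (∀ s → enab gcs s ≡ true) → WFG gcs → WF (ifc n gcs)
    wf-do     : ∀ {n gcs} → WFG gcs → WF (doc n gcs)

  data WFG : GCs → Set where
    wfg-one  : ∀ {e c} → WF c → WFG [ e ⇒ c ]
    wfg-cons : ∀ {e c gcs} → WF c → WFG gcs → WFG (e ⇒ c □ gcs)

okf : Cmd → Label → Set
okf c f = All (λ n → + 0 < n) (labs c) × Unique (labs c) × f ∉ labs c

data Sub : Label → Cmd → Cmd → Set where
  sub-skip   : ∀ {n} → Sub n (skip n) (skip n)
  sub-assign : ∀ {n x e} → Sub n (assign n x e) (assign n x e)
  sub-if     : ∀ {n gcs} → Sub n (ifc n gcs) (ifc n gcs)
  sub-do     : ∀ {n gcs} → Sub n (doc n gcs) (doc n gcs)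
  sub-seqˡ   : ∀ {n c d x} → n ∈ labs c → Sub n c x → Sub n (c ⨾ d) x
  sub-seqʳ   : ∀ {n c d x} → n ∉ labs c → Sub n d x → Sub n (c ⨾ d) x
  sub-if-in  : ∀ {m n gcs e d x} → e ⇒ d ∈gcs gcs → m ∈ labs d → Sub m d x → Sub m (ifc n gcs) x
  sub-do-in  : ∀ {m n gcs e d x} → e ⇒ d ∈gcs gcs → m ∈ labs d → Sub m d x → Sub m (doc n gcs) x

data Fsuc : Label → Cmd → Label → Label → Set where
  fs-skip   : ∀ {n f} → Fsuc n (skip n) f f
  fs-assign : ∀ {n x e f} → Fsuc n (assign n x e) f f
  fs-if     : ∀ {n gcs f} → Fsuc n (ifc n gcs) f f
  fs-do     : ∀ {n gcs f} → Fsuc n (doc n gcs) f f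
  fs-seqˡ   : ∀ {n c d f m} → n ∈ labs c → Fsuc n c (lab d) m → Fsuc n (c ⨾ d) f m
  fs-seqʳ   : ∀ {n c d f m} → n ∉ labs c → Fsuc n d f m → Fsuc n (c ⨾ d) f m
  fs-if-in  : ∀ {m n gcs e d f k} → e ⇒ d ∈gcs gcs → m ∈ labs d → Fsuc m d f k → Fsuc m (ifc n gcs) f k
  fs-do-in  : ∀ {m n gcs e d f k} → e ⇒ d ∈gcs gcs → m ∈ labs d → Fsuc m d n k → Fsuc m (doc n gcs) f k

data Step : Cmd → Store → Cmd → Store → Set where
  st-if      : ∀ {n gcs e d s} → e ⇒ d ∈gcs gcs → e s ≡ true → Step (ifc n gcs) s d s
  st-do      : ∀ {n gcs e d s} → e ⇒ d ∈gcs gcs → e s ≡ true → Step (doc n gcs) s (d ⨾ doc n gcs) s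
  st-do-exit : ∀ {n gcs s} → enab gcs s ≡ false → Step (doc n gcs) s (skip (- n)) s
  st-assign  : ∀ {n x e s} → Step (assign n x e) s (skip (- n)) (s [ x ↦ e s ])
  st-skip    : ∀ {n c s} → Step (skip n ⨾ c) s c s
  st-seq     : ∀ {c b d s t} → Step c s d t → Step (c ⨾ b) s (d ⨾ b) t

data AutStep (c : Cmd) (f : Label) : Label → Store → Label → Store → Set where
  aut-pos  : ∀ {n s m t d₀ d} → Sub n c d₀ → Step d₀ s d t → + 0 < lab d → m ≡ lab d
           → AutStep c f n s m t
  aut-neg  : ∀ {n s m t d₀ d} → Sub n c d₀ → Step d₀ s d t → lab d < + 0 → Fsuc n c f m
           → AutStep c f n s m t
  aut-skip : ∀ {n s m} → Sub n c (skip n) → Fsuc n c f m → AutStep c f n s m s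

ControlPoint : Cmd → Label → Label → Set
ControlPoint c f n = n ∈ labs c ⊎ n ≡ f

{-# OPTIONS --safe #-}
-- Every non-final control point n is a label of c, so sub(n,c) exists and is
-- a skip, assignment, alternative or repetition labelled n, and fsuc(n,c,f)
-- exists.  A skip moves to fsuc; an assignment, and a repetition whose guards
-- are all false, step to skip⁻ⁿ, whose label is negative since labels are
-- positive, and so move to fsuc; well-formedness makes some guard of an
-- alternative true, and a true guard of an alternative or repetition leads to
-- a command whose label is a label of c, hence positive.
module Submission where

open import Defs
open import Data.Integer using (+_; -_; _<_; _≟_)
open import Data.Integer.Properties using (neg-mono-<)
open import Data.Bool using (true; false)
open import Data.List.Membership.Propositional using (_∈_)
open import Data.List.Membership.Propositional.Properties using (∈-++⁺ˡ; ∈-++⁺ʳ; ∈-++⁻)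
open import Data.List.Membership.DecPropositional _≟_ using (_∈?_)
open import Data.List.Relation.Unary.Any using (here; there)
import Data.List.Relation.Unary.All as All
open import Data.Product using (Σ; ∃; _×_; _,_)
open import Data.Sum using (_⊎_; inj₁; inj₂)
open import Data.Empty using (⊥-elim)
open import Relation.Nullary using (yes; no)
open import Relation.Binary.PropositionalEquality using (_≡_; _≢_; refl; sym; subst)

lab∈labs : ∀ c → lab c ∈ labs c
lab∈labs (skip n)       = here refl
lab∈labs (assign n x e) = here refl
lab∈labs (c ⨾ d)        = ∈-++⁺ˡ (lab∈labs c)
lab∈labs (ifc n gcs)    = here refl
lab∈labs (doc n gcs)    = here refl

branch-labs⊆labsG : ∀ {e d gcs k} → e ⇒ d ∈gcs gcs → k ∈ labs d → k ∈ labsG gcs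
branch-labs⊆labsG here₁                  k∈d = k∈d
branch-labs⊆labsG here                   k∈d = ∈-++⁺ˡ k∈d
branch-labs⊆labsG (there {d' = d'} e⇒d) k∈d = ∈-++⁺ʳ (labs d') (branch-labs⊆labsG e⇒d k∈d)

enab⇒enabled-branch : ∀ gcs s → enab gcs s ≡ true →
                      ∃ λ e → ∃ λ d → e ⇒ d ∈gcs gcs × e s ≡ true
enab⇒enabled-branch [ e ⇒ d ] s es = e , d , here₁ , es
enab⇒enabled-branch (e ⇒ d □ gcs) s enab≡true with e s in es
... | true  = e , d , here , es
... | false with enab⇒enabled-branch gcs s enab≡true
...   | e′ , d′ , e′⇒d′ , e′s = e′ , d′ , there e′⇒d′ , e′s

WFG-branch : ∀ {e d gcs} → e ⇒ d ∈gcs gcs → WFG gcs → WF d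
WFG-branch here₁         (wfg-one wf)    = wf
WFG-branch here          (wfg-cons wf _) = wf
WFG-branch (there e⇒d) (wfg-cons _ wfs) = WFG-branch e⇒d wfs

Sub-labs⊆ : ∀ {n c x k} → Sub n c x → k ∈ labs x → k ∈ labs c
Sub-labs⊆ sub-skip                    k∈x = k∈x
Sub-labs⊆ sub-assign                  k∈x = k∈x
Sub-labs⊆ sub-if                      k∈x = k∈x
Sub-labs⊆ sub-do                      k∈x = k∈x
Sub-labs⊆ (sub-seqˡ _ sub)            k∈x = ∈-++⁺ˡ (Sub-labs⊆ sub k∈x)
Sub-labs⊆ (sub-seqʳ {c = c} _ sub)    k∈x = ∈-++⁺ʳ (labs c) (Sub-labs⊆ sub k∈x)
Sub-labs⊆ (sub-if-in e⇒d _ sub)      k∈x = there (branch-labs⊆labsG e⇒d (Sub-labs⊆ sub k∈x))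
Sub-labs⊆ (sub-do-in e⇒d _ sub)      k∈x = there (branch-labs⊆labsG e⇒d (Sub-labs⊆ sub k∈x))

Sub-WF : ∀ {n c x} → Sub n c x → WF c → WF x
Sub-WF sub-skip                 wf                = wf
Sub-WF sub-assign               wf                = wf
Sub-WF sub-if                   wf                = wf
Sub-WF sub-do                   wf                = wf
Sub-WF (sub-seqˡ _ sub)         (wf-seq wf _)     = Sub-WF sub wf
Sub-WF (sub-seqʳ _ sub)         (wf-seq _ wf)     = Sub-WF sub wf
Sub-WF (sub-if-in e⇒d _ sub)   (wf-if _ wfs)     = Sub-WF sub (WFG-branch e⇒d wfs)
Sub-WF (sub-do-in e⇒d _ sub)   (wf-do wfs)       = Sub-WF sub (WFG-branch e⇒d wfs)

data Atomic (n : Label) : Cmd → Set where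
  skip   : Atomic n (skip n)
  assign : ∀ {x e} → Atomic n (assign n x e)
  ifc    : ∀ {gcs} → Atomic n (ifc n gcs)
  doc    : ∀ {gcs} → Atomic n (doc n gcs)

Sub-Atomic : ∀ {n c x} → Sub n c x → Atomic n x
Sub-Atomic sub-skip              = skip
Sub-Atomic sub-assign            = assign
Sub-Atomic sub-if                = ifc
Sub-Atomic sub-do                = doc
Sub-Atomic (sub-seqˡ _ sub)      = Sub-Atomic sub
Sub-Atomic (sub-seqʳ _ sub)      = Sub-Atomic sub
Sub-Atomic (sub-if-in _ _ sub)   = Sub-Atomic sub
Sub-Atomic (sub-do-in _ _ sub)   = Sub-Atomic sub

mutual
  labs⇒Sub : ∀ {n} c → n ∈ labs c → Σ Cmd (Sub n c)
  labs⇒Sub (skip n)       (here refl) = _ , sub-skip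
  labs⇒Sub (assign n x e) (here refl) = _ , sub-assign
  labs⇒Sub {n} (c ⨾ d) n∈c⨾d with n ∈? labs c
  ... | yes n∈c = let x , sub = labs⇒Sub c n∈c in x , sub-seqˡ n∈c sub
  ... | no n∉c with ∈-++⁻ (labs c) n∈c⨾d
  ...   | inj₁ n∈c = ⊥-elim (n∉c n∈c)
  ...   | inj₂ n∈d = let x , sub = labs⇒Sub d n∈d in x , sub-seqʳ n∉c sub
  labs⇒Sub (ifc n gcs) (here refl) = _ , sub-if
  labs⇒Sub (ifc n gcs) (there n∈gcs) with labsG⇒Sub gcs n∈gcs
  ... | _ , _ , e⇒d , n∈d , x , sub = x , sub-if-in e⇒d n∈d sub
  labs⇒Sub (doc n gcs) (here refl) = _ , sub-do
  labs⇒Sub (doc n gcs) (there n∈gcs) with labsG⇒Sub gcs n∈gcs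
  ... | _ , _ , e⇒d , n∈d , x , sub = x , sub-do-in e⇒d n∈d sub

  labsG⇒Sub : ∀ {n} gcs → n ∈ labsG gcs →
              ∃ λ e → ∃ λ d → e ⇒ d ∈gcs gcs × n ∈ labs d × Σ Cmd (Sub n d)
  labsG⇒Sub [ e ⇒ d ] n∈d = e , d , here₁ , n∈d , labs⇒Sub d n∈d
  labsG⇒Sub (e ⇒ d □ gcs) n∈ with ∈-++⁻ (labs d) n∈
  ... | inj₁ n∈d = e , d , here , n∈d , labs⇒Sub d n∈d
  ... | inj₂ n∈gcs with labsG⇒Sub gcs n∈gcs
  ...   | e′ , d′ , e′⇒d′ , n∈d′ , sub = e′ , d′ , there e′⇒d′ , n∈d′ , sub

mutual
  labs⇒Fsuc : ∀ {n} c f → n ∈ labs c → Σ Label (Fsuc n c f)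
  labs⇒Fsuc (skip n)       f (here refl) = _ , fs-skip
  labs⇒Fsuc (assign n x e) f (here refl) = _ , fs-assign
  labs⇒Fsuc {n} (c ⨾ d) f n∈c⨾d with n ∈? labs c
  ... | yes n∈c = let m , fs = labs⇒Fsuc c (lab d) n∈c in m , fs-seqˡ n∈c fs
  ... | no n∉c with ∈-++⁻ (labs c) n∈c⨾d
  ...   | inj₁ n∈c = ⊥-elim (n∉c n∈c)
  ...   | inj₂ n∈d = let m , fs = labs⇒Fsuc d f n∈d in m , fs-seqʳ n∉c fs
  labs⇒Fsuc (ifc n gcs) f (here refl) = _ , fs-if
  labs⇒Fsuc (ifc n gcs) f (there n∈gcs) with labsG⇒Fsuc gcs f n∈gcs
  ... | _ , _ , e⇒d , n∈d , m , fs = m , fs-if-in e⇒d n∈d fs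
  labs⇒Fsuc (doc n gcs) f (here refl) = _ , fs-do
  labs⇒Fsuc (doc n gcs) f (there n∈gcs) with labsG⇒Fsuc gcs n n∈gcs
  ... | _ , _ , e⇒d , n∈d , m , fs = m , fs-do-in e⇒d n∈d fs

  labsG⇒Fsuc : ∀ {n} gcs f → n ∈ labsG gcs →
               ∃ λ e → ∃ λ d → e ⇒ d ∈gcs gcs × n ∈ labs d × Σ Label (Fsuc n d f)
  labsG⇒Fsuc [ e ⇒ d ] f n∈d = e , d , here₁ , n∈d , labs⇒Fsuc d f n∈d
  labsG⇒Fsuc (e ⇒ d □ gcs) f n∈ with ∈-++⁻ (labs d) n∈
  ... | inj₁ n∈d = e , d , here , n∈d , labs⇒Fsuc d f n∈d
  ... | inj₂ n∈gcs with labsG⇒Fsuc gcs f n∈gcs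
  ...   | e′ , d′ , e′⇒d′ , n∈d′ , fs = e′ , d′ , there e′⇒d′ , n∈d′ , fs

Atomic-progress : ∀ {n x} s → Atomic n x → WF x →
                  x ≡ skip n ⊎
                  ∃ λ d → ∃ λ t → Step x s d t × (lab d ∈ labs x ⊎ lab d ≡ - n)
Atomic-progress s skip   _ = inj₁ refl
Atomic-progress s assign _ = inj₂ (_ , _ , st-assign , inj₂ refl)
Atomic-progress s (ifc {gcs}) (wf-if enabled _)
  with enab⇒enabled-branch gcs s (enabled s)
... | _ , d , e⇒d , es =
  inj₂ (d , s , st-if e⇒d es , inj₁ (there (branch-labs⊆labsG e⇒d (lab∈labs d))))
Atomic-progress s (doc {gcs}) _ with enab gcs s in enab≡
... | false = inj₂ (_ , s , st-do-exit enab≡ , inj₂ refl)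
... | true with enab⇒enabled-branch gcs s enab≡
...   | _ , d , e⇒d , es =
  inj₂ (_ , s , st-do e⇒d es , inj₁ (there (branch-labs⊆labsG e⇒d (lab∈labs d))))

lemma3p21 : (c : Cmd) (f : Label) → WF c → okf c f →
    (n : Label) (s : Store) → ControlPoint c f n → n ≢ f →
    Σ Label (λ m → Σ Store (λ t → AutStep c f n s m t))
lemma3p21 c f wf (positive , _) n s (inj₂ n≡f) n≢f = ⊥-elim (n≢f n≡f)
lemma3p21 c f wf (positive , _) n s (inj₁ n∈c) _
  with labs⇒Sub c n∈c | labs⇒Fsuc c f n∈c
... | x , sub | m , fsuc with Atomic-progress s (Sub-Atomic sub) (Sub-WF sub wf)
...   | inj₁ refl = m , s , aut-skip sub fsuc
...   | inj₂ (d , t , step , inj₁ ld∈x) =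
  lab d , t , aut-pos sub step (All.lookup positive (Sub-labs⊆ sub ld∈x)) refl
...   | inj₂ (d , t , step , inj₂ ld≡-n) =
  m , t , aut-neg sub step ld<0 fsuc
  where
  ld<0 : lab d < + 0
  ld<0 = subst (_< + 0) (sym ld≡-n) (neg-mono-< (All.lookup positive n∈c))
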